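{- Let $M$ be a matroid and $(Z,A)$ a partition of $E(M)$ with $\lambda_M(Z)=t>0$. Let $M_t$ be the matroid obtained by freely adding the set $\{e_1,\ldots,e_t\}$ into the guts of $Z$. Then $\{e_1,\ldots,e_t\}$ is an independent set of clones in $M_t$. Moreover, $\mathrm{cl}_{M_t}(A)\cap\mathrm{cl}_{M_t}(Z)$ contains and is spanned by $\{e_1,\ldots,e_t\}$.
   Context: For a matroid $N$ with rank function $r$, $\lambda_N(X)=r(X)+r(E(N)-X)-r(N)$. A set $S\subseteq E(N)$ is a set of clones if every permutation of $E(N)$ fixing each element outside $S$ is an automorphism of $N$. Freely adding $e\notin E(N)$ into the guts of $Z\subseteq E(N)$: the single-element extension $N'$ of $N$ by $e$ such that, for each $X\subseteq E(N)$, $r_{N'}(X\cup\{e\})=r_N(X)$ if $\lambda_{N/X}(Z-X)=0$ and $r_{N'}(X\cup\{e\})=r_N(X)+1$ otherwise. Freely adding $\{e_1,\ldots,e_s\}$ into the guts of $Z$: set $M_0=M$ and let $M_i$ be obtained from $M_{i-1}$ by freely adding $e_i$ into the guts of $Z$, for $i=1,\ldots,s$. -}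

module Defs where

open import Data.Nat using (ℕ; zero; suc; _+_; _∸_; _≤_; _≡ᵇ_)
open import Data.Bool using (Bool; true; false; if_then_else_)
open import Data.Fin using (Fin)
open import Data.Fin.Subset using (Subset; ⊤; ⊥; ∁; _∪_; _∩_; _─_; _⊆_; _∉_; ⁅_⁆; ∣_∣)
open import Data.Fin.Permutation using (Permutation′; _⟨$⟩ʳ_; _⟨$⟩ˡ_)
open import Data.Vec using (Vec; _∷_; []; replicate; _++_; tabulate; lookup)
open import Relation.Binary.PropositionalEquality using (_≡_)

RankFn : ℕ → Set
RankFn n = Subset n → ℕ

record IsMatroid {n : ℕ} (r : RankFn n) : Set where
  field
    R1 : ∀ X → r X ≤ ∣ X ∣
    R2 : ∀ X Y → X ⊆ Y → r X ≤ r Y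
    R3 : ∀ X Y → r (X ∪ Y) + r (X ∩ Y) ≤ r X + r Y

lam : {n : ℕ} → RankFn n → Subset n → Subset n → ℕ
lam r E W = (r W + r (E ─ W)) ∸ r E

λM : {n : ℕ} → RankFn n → Subset n → ℕ
λM r X = lam r ⊤ X

-- Rank function of the contraction N / X (meaningful on subsets of E - X):
-- r_{N/X}(Y) = r(Y ∪ X) - r(X).
contract : {n : ℕ} → RankFn n → Subset n → RankFn n
contract r X Y = r (Y ∪ X) ∸ r X

λContr : {n : ℕ} → RankFn n → Subset n → Subset n → ℕ
λContr r X Z = lam (contract r X) (⊤ ─ X) (Z ─ X)

-- Freely adding a new element e into the guts of Z.  The new element is
-- index zero of Fin (suc n); old element i becomes suc i.
freeAddOne : {n : ℕ} → RankFn n → Subset n → RankFn (suc n)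
freeAddOne r Z (false ∷ X) = r X
freeAddOne r Z (true ∷ X) =
  if λContr r X Z ≡ᵇ 0 then r X else suc (r X)

-- Z viewed as a subset of E(M_t) (new elements e_t,...,e_1 occupy the first t indices).
liftSub : {n : ℕ} (t : ℕ) → Subset n → Subset (t + n)
liftSub t Z = replicate t false ++ Z

newElts : (t n : ℕ) → Subset (t + n)
newElts t n = replicate t true ++ replicate n false

-- M_t: freely adding {e_1,...,e_t} into the guts of Z, one at a time.
-- (e_i is the element added at step i; in M_t it sits at index t - i.)
freeAdd : {n : ℕ} (t : ℕ) → RankFn n → Subset n → RankFn (t + n)
freeAdd zero    r Z = r
freeAdd (suc t) r Z = freeAddOne (freeAdd t r Z) (liftSub t Z)

Independent : {n : ℕ} → RankFn n → Subset n → Set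
Independent r X = r X ≡ ∣ X ∣

cl : {n : ℕ} → RankFn n → Subset n → Subset n
cl r X = tabulate (λ e → r (X ∪ ⁅ e ⁆) ≡ᵇ r X)

image : {n : ℕ} → Permutation′ n → Subset n → Subset n
image σ X = tabulate (λ j → lookup X (σ ⟨$⟩ˡ j))

IsAutomorphism : {n : ℕ} → RankFn n → Permutation′ n → Set
IsAutomorphism r σ = ∀ X → r (image σ X) ≡ r X

IsClones : {n : ℕ} → RankFn n → Subset n → Set
IsClones {n} r S = (σ : Permutation′ n) →
  (∀ x → x ∉ S → σ ⟨$⟩ʳ x ≡ x) → IsAutomorphism r σ

{-# OPTIONS --safe #-}
-- Write a subset of E(M_t) as S ++ X, with S among the new elements and X ⊆ E(M). Induction on t
-- gives the closed form  r_t(S ++ X) = r(X) + min(|S|, λ_{M/X}(Z − X)),  where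
-- λ_{M/X}(Z − X) = r(Z ∪ X) + r(A ∪ X) − r(E) − r(X): adding e_{s+1} to S ++ X raises the rank
-- exactly when the connectivity λ_{M/X}(Z − X) − |S| left in M_s / (S ++ X) is positive.
-- Everything is read off this formula. It depends on S only through |S|, so the new elements are
-- clones; at X = ∅ it gives rank min(t, λ(Z)) = t, so they are independent; λ_{M/X}(Z − X) = 0
-- when X contains Z or A, so they lie in cl(Z) and cl(A); and an old element e of cl(Z) ∩ cl(A)
-- has λ_{M/e}(Z − e) = t − r(e), so adding it to {e_1,…,e_t} keeps the rank at t.
module Submission where

open import Defs
open import Data.Nat using (ℕ; _<_; zero; suc; _+_; _∸_; _≤_; _⊓_; s≤s; _≡ᵇ_)
open import Data.Nat.Properties
open import Data.Product using (_×_; _,_; proj₁; proj₂)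
open import Data.Fin.Subset using (Subset; ∁; _∩_; _⊆_; _∪_; _─_; ⊤; ⊥; ⁅_⁆; ∣_∣; _∈_; _∉_)
open import Relation.Binary.PropositionalEquality
  using (_≡_; refl; sym; trans; cong; cong₂; subst; module ≡-Reasoning)

open import Algebra.Properties.CommutativeMonoid.Sum +-0-commutativeMonoid
  using (sum; sum-permute; sum-cong-≗)
open import Data.Bool using (Bool; true; false; not; _∨_; if_then_else_)
open import Data.Bool.Properties using (T-≡)
open import Data.Fin using (Fin; zero; suc; _↑ˡ_; _↑ʳ_)
open import Data.Fin.Permutation as Perm using (Permutation′; _⟨$⟩ʳ_; _⟨$⟩ˡ_; inverseˡ)
open import Data.Fin.Subset.Properties
  using (⊆⊤; ⊆-refl; ⊆-antisym; p⊆p∪q; q⊆p∪q; x∈p∪q⁻; x∈p∩q⁺; x∈p∩q⁻; x∈⁅y⁆⇒x≡y;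
         ∣⊤∣≡n; ∣⊥∣≡0; ∣⁅x⁆∣≡1; p∪∁p≡⊤; ∪-assoc; ∪-comm; ∪-identityˡ; ∪-identityʳ; ∪-inverseˡ; ∪-zeroˡ)
open import Data.Sum using ([_,_])
open import Data.Vec using ([]; _∷_; _++_; replicate; lookup; take; drop)
open import Data.Vec.Properties
  using (lookup∘tabulate; tabulate∘lookup; tabulate-cong; []=⇒lookup; lookup⇒[]=;
         lookup-++ˡ; lookup-++ʳ; lookup-replicate; map-++; zipWith-++; take++drop≡id)
open import Function using (id)
open import Function.Bundles using (Equivalence)
open import Relation.Nullary using (contradiction)

open ≡-Reasoning

private
  variable
    n t : ℕ

[m∸o]+[n∸o]∸[p∸o]≡m+n∸[p+o] : ∀ o {m n p} → o ≤ m → o ≤ n → o ≤ p →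
                                ((m ∸ o) + (n ∸ o)) ∸ (p ∸ o) ≡ (m + n) ∸ (p + o)
[m∸o]+[n∸o]∸[p∸o]≡m+n∸[p+o] zero {p = p} _ _ _ = cong (_ ∸_) (sym (+-identityʳ p))
[m∸o]+[n∸o]∸[p∸o]≡m+n∸[p+o] (suc o) {suc m} {suc n} {suc p} (s≤s o≤m) (s≤s o≤n) (s≤s o≤p) =
  trans ([m∸o]+[n∸o]∸[p∸o]≡m+n∸[p+o] o o≤m o≤n o≤p)
        (sym (cong₂ _∸_ (+-suc m n) (+-suc p o)))

k≤[a+b]∸[c+x]⇒x+k≤a : ∀ {a b c x k} → x ≤ a → b ≤ c → k ≤ (a + b) ∸ (c + x) → x + k ≤ a
k≤[a+b]∸[c+x]⇒x+k≤a {a} {b} {c} {x} {k} x≤a b≤c k≤ = ≤-trans (+-monoʳ-≤ x k≤a∸x) (≤-reflexive (m+[n∸m]≡n x≤a))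
  where
  k≤a∸x : k ≤ a ∸ x
  k≤a∸x = ≤-trans k≤ (≤-trans (∸-monoˡ-≤ (c + x) (+-monoʳ-≤ a b≤c))
                              (≤-reflexive (trans (cong (_∸ (c + x)) (+-comm a c)) ([m+n]∸[m+o]≡n∸o c a x))))

+-⊓-step : ∀ x s k → (if (k ∸ s) ≡ᵇ 0 then x + (s ⊓ k) else suc (x + (s ⊓ k))) ≡ x + (suc s ⊓ k)
+-⊓-step x zero    zero    = refl
+-⊓-step x (suc s) zero    = refl
+-⊓-step x zero    (suc k) = sym (+-suc x 0)
+-⊓-step x (suc s) (suc k) rewrite +-suc x (s ⊓ k) | +-suc x (suc s ⊓ k) = +-⊓-step (suc x) s k

m∸[n⊓m]≡m∸n : ∀ m n → m ∸ (n ⊓ m) ≡ m ∸ n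
m∸[n⊓m]≡m∸n m n = begin
  m ∸ (n ⊓ m)                    ≡⟨ cong (_∸ (n ⊓ m)) (m⊓n+n∸m≡n n m) ⟨
  ((n ⊓ m) + (m ∸ n)) ∸ (n ⊓ m)  ≡⟨ m+n∸m≡n (n ⊓ m) (m ∸ n) ⟩
  m ∸ n                          ∎

p─q∪q≡p∪q : (p q : Subset n) → (p ─ q) ∪ q ≡ p ∪ q
p─q∪q≡p∪q []          []          = refl
p─q∪q≡p∪q (true ∷ p)  (true ∷ q)  = cong (true ∷_) (p─q∪q≡p∪q p q)
p─q∪q≡p∪q (false ∷ p) (true ∷ q)  = cong (true ∷_) (p─q∪q≡p∪q p q)
p─q∪q≡p∪q (true ∷ p)  (false ∷ q) = cong (true ∷_) (p─q∪q≡p∪q p q)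
p─q∪q≡p∪q (false ∷ p) (false ∷ q) = cong (false ∷_) (p─q∪q≡p∪q p q)

[⊤─q]─[p─q]∪q≡∁p∪q : (p q : Subset n) → ((⊤ ─ q) ─ (p ─ q)) ∪ q ≡ ∁ p ∪ q
[⊤─q]─[p─q]∪q≡∁p∪q []          []          = refl
[⊤─q]─[p─q]∪q≡∁p∪q (true ∷ p)  (true ∷ q)  = cong (true ∷_) ([⊤─q]─[p─q]∪q≡∁p∪q p q)
[⊤─q]─[p─q]∪q≡∁p∪q (false ∷ p) (true ∷ q)  = cong (true ∷_) ([⊤─q]─[p─q]∪q≡∁p∪q p q)
[⊤─q]─[p─q]∪q≡∁p∪q (true ∷ p)  (false ∷ q) = cong (false ∷_) ([⊤─q]─[p─q]∪q≡∁p∪q p q)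
[⊤─q]─[p─q]∪q≡∁p∪q (false ∷ p) (false ∷ q) = cong (true ∷_) ([⊤─q]─[p─q]∪q≡∁p∪q p q)

⊤─p≡∁p : (p : Subset n) → ⊤ ─ p ≡ ∁ p
⊤─p≡∁p []          = refl
⊤─p≡∁p (true ∷ p)  = cong (false ∷_) (⊤─p≡∁p p)
⊤─p≡∁p (false ∷ p) = cong (true ∷_) (⊤─p≡∁p p)

p⊆q⇒p∪q≡q : {p q : Subset n} → p ⊆ q → p ∪ q ≡ q
p⊆q⇒p∪q≡q {p = p} {q} p⊆q = ⊆-antisym (λ x∈p∪q → [ p⊆q , id ] (x∈p∪q⁻ p q x∈p∪q)) (q⊆p∪q p q)

p∪q≡⊤⇒p∪s≡⊤ : {p q s : Subset n} → p ∪ q ≡ ⊤ → q ⊆ s → p ∪ s ≡ ⊤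
p∪q≡⊤⇒p∪s≡⊤ {p = p} {q} {s} p∪q≡⊤ q⊆s = begin
  p ∪ s        ≡⟨ cong (p ∪_) (p⊆q⇒p∪q≡q q⊆s) ⟨
  p ∪ (q ∪ s)  ≡⟨ ∪-assoc p q s ⟨
  (p ∪ q) ∪ s  ≡⟨ cong (_∪ s) p∪q≡⊤ ⟩
  ⊤ ∪ s        ≡⟨ ∪-zeroˡ s ⟩
  ⊤            ∎

x∈p⇒p∪⁅x⁆≡p : {p : Subset n} {x : Fin n} → x ∈ p → p ∪ ⁅ x ⁆ ≡ p
x∈p⇒p∪⁅x⁆≡p {p = p} {x} x∈p = trans (∪-comm p ⁅ x ⁆)
  (p⊆q⇒p∪q≡q (λ y∈⁅x⁆ → subst (_∈ p) (sym (x∈⁅y⁆⇒x≡y x y∈⁅x⁆)) x∈p))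

replicate-++ : ∀ t (b : Bool) → replicate (t + n) b ≡ replicate t b ++ replicate n b
replicate-++ zero    b = refl
replicate-++ (suc t) b = cong (b ∷_) (replicate-++ t b)

⁅↑ˡ⁆ : ∀ n (i : Fin t) → ⁅ i ↑ˡ n ⁆ ≡ ⁅ i ⁆ ++ ⊥ {n}
⁅↑ˡ⁆ {suc t} n zero    = cong (true ∷_) (replicate-++ t false)
⁅↑ˡ⁆         n (suc i) = cong (false ∷_) (⁅↑ˡ⁆ n i)

⁅↑ʳ⁆ : ∀ t (j : Fin n) → ⁅ t ↑ʳ j ⁆ ≡ ⊥ {t} ++ ⁅ j ⁆
⁅↑ʳ⁆ zero    j = refl
⁅↑ʳ⁆ (suc t) j = cong (false ∷_) (⁅↑ʳ⁆ t j)

liftSub∪⁅new⁆ : ∀ t (W : Subset n) (i : Fin t) → liftSub t W ∪ ⁅ i ↑ˡ n ⁆ ≡ ⁅ i ⁆ ++ W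
liftSub∪⁅new⁆ {n} t W i = begin
  liftSub t W ∪ ⁅ i ↑ˡ n ⁆    ≡⟨ cong (liftSub t W ∪_) (⁅↑ˡ⁆ n i) ⟩
  liftSub t W ∪ (⁅ i ⁆ ++ ⊥)  ≡⟨ zipWith-++ _∨_ ⊥ W ⁅ i ⁆ ⊥ ⟩
  (⊥ ∪ ⁅ i ⁆) ++ (W ∪ ⊥)   ≡⟨ cong₂ _++_ (∪-identityˡ ⁅ i ⁆) (∪-identityʳ W) ⟩
  ⁅ i ⁆ ++ W               ∎

liftSub∪⁅old⁆ : ∀ t (W : Subset n) j → liftSub t W ∪ ⁅ t ↑ʳ j ⁆ ≡ liftSub t (W ∪ ⁅ j ⁆)
liftSub∪⁅old⁆ t W j = begin
  liftSub t W ∪ ⁅ t ↑ʳ j ⁆    ≡⟨ cong (liftSub t W ∪_) (⁅↑ʳ⁆ t j) ⟩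
  liftSub t W ∪ (⊥ ++ ⁅ j ⁆)  ≡⟨ zipWith-++ _∨_ ⊥ W ⊥ ⁅ j ⁆ ⟩
  (⊥ ∪ ⊥) ++ (W ∪ ⁅ j ⁆)     ≡⟨ cong (_++ (W ∪ ⁅ j ⁆)) (∪-identityˡ ⊥) ⟩
  ⊥ ++ (W ∪ ⁅ j ⁆)           ∎

newElts∪⁅old⁆ : ∀ t (j : Fin n) → newElts t n ∪ ⁅ t ↑ʳ j ⁆ ≡ ⊤ ++ ⁅ j ⁆
newElts∪⁅old⁆ {n} t j = begin
  newElts t n ∪ ⁅ t ↑ʳ j ⁆    ≡⟨ cong (newElts t n ∪_) (⁅↑ʳ⁆ t j) ⟩
  newElts t n ∪ (⊥ ++ ⁅ j ⁆)  ≡⟨ zipWith-++ _∨_ ⊤ ⊥ ⊥ ⁅ j ⁆ ⟩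
  (⊤ ∪ ⊥) ++ (⊥ ∪ ⁅ j ⁆)     ≡⟨ cong₂ _++_ (∪-identityʳ ⊤) (∪-identityˡ ⁅ j ⁆) ⟩
  ⊤ ++ ⁅ j ⁆                 ∎

∣p++q∣≡∣p∣+∣q∣ : (p : Subset t) (q : Subset n) → ∣ p ++ q ∣ ≡ ∣ p ∣ + ∣ q ∣
∣p++q∣≡∣p∣+∣q∣ []          q = refl
∣p++q∣≡∣p∣+∣q∣ (true ∷ p)  q = cong suc (∣p++q∣≡∣p∣+∣q∣ p q)
∣p++q∣≡∣p∣+∣q∣ (false ∷ p) q = ∣p++q∣≡∣p∣+∣q∣ p q

∣image∣≡∣p∣ : (σ : Permutation′ n) (p : Subset n) → ∣ image σ p ∣ ≡ ∣ p ∣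
∣image∣≡∣p∣ σ p = begin
  ∣ image σ p ∣                         ≡⟨ ∣q∣≡sum (image σ p) ⟩
  sum (λ i → 𝟙 (lookup (image σ p) i))  ≡⟨ sum-cong-≗ (λ i → cong 𝟙 (lookup∘tabulate (λ j → lookup p (σ ⟨$⟩ˡ j)) i)) ⟩
  sum (λ i → 𝟙 (lookup p (σ ⟨$⟩ˡ i)))   ≡⟨ sum-permute (λ i → 𝟙 (lookup p i)) (Perm.flip σ) ⟨
  sum (λ i → 𝟙 (lookup p i))            ≡⟨ ∣q∣≡sum p ⟨
  ∣ p ∣                                 ∎
  where
  𝟙 : Bool → ℕ
  𝟙 b = if b then 1 else 0
  ∣q∣≡sum : ∀ {m} (q : Subset m) → ∣ q ∣ ≡ sum (λ i → 𝟙 (lookup q i))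
  ∣q∣≡sum []          = refl
  ∣q∣≡sum (true ∷ q)  = cong suc (∣q∣≡sum q)
  ∣q∣≡sum (false ∷ q) = ∣q∣≡sum q

∈cl⁺ : (R : RankFn n) {X : Subset n} {x : Fin n} → R (X ∪ ⁅ x ⁆) ≡ R X → x ∈ cl R X
∈cl⁺ R {X} {x} eq = lookup⇒[]= x (cl R X)
  (trans (lookup∘tabulate _ x) (Equivalence.to T-≡ (≡⇒≡ᵇ _ _ eq)))

∈cl⁻ : (R : RankFn n) {X : Subset n} {x : Fin n} → x ∈ cl R X → R (X ∪ ⁅ x ⁆) ≡ R X
∈cl⁻ R {X} {x} x∈cl = ≡ᵇ⇒≡ _ _
  (Equivalence.from T-≡ (trans (sym (lookup∘tabulate _ x)) ([]=⇒lookup x∈cl)))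

∈⇒∈cl : (R : RankFn n) {X : Subset n} {x : Fin n} → x ∈ X → x ∈ cl R X
∈⇒∈cl R x∈X = ∈cl⁺ R (cong R (x∈p⇒p∪⁅x⁆≡p x∈X))

data NewOrOld (t : ℕ) {n : ℕ} : Fin (t + n) → Set where
  new : (i : Fin t) → NewOrOld t (i ↑ˡ n)
  old : (j : Fin n) → NewOrOld t (t ↑ʳ j)

newOrOld : ∀ t (x : Fin (t + n)) → NewOrOld t x
newOrOld zero    x       = old x
newOrOld (suc t) zero    = new zero
newOrOld (suc t) (suc x) with newOrOld t x
... | new i = new (suc i)
... | old j = old j

new∈newElts : (i : Fin t) → i ↑ˡ n ∈ newElts t n
new∈newElts {n = n} i = lookup⇒[]= _ _ (trans (lookup-++ˡ ⊤ (⊥ {n}) i) (lookup-replicate i true))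

old∉newElts : (j : Fin n) → t ↑ʳ j ∉ newElts t n
old∉newElts {t = t} j j∈N with trans (sym ([]=⇒lookup j∈N)) (trans (lookup-++ʳ (⊤ {t}) ⊥ j) (lookup-replicate j false))
... | ()

lookup-drop : ∀ t (U : Subset (t + n)) j → lookup (drop t U) j ≡ lookup U (t ↑ʳ j)
lookup-drop t U j = trans (sym (lookup-++ʳ (take t U) _ j)) (cong (λ U′ → lookup U′ (t ↑ʳ j)) (take++drop≡id t U))

∣take∣+∣drop∣≡∣p∣ : ∀ t (p : Subset (t + n)) → ∣ take t p ∣ + ∣ drop t p ∣ ≡ ∣ p ∣
∣take∣+∣drop∣≡∣p∣ t p = trans (sym (∣p++q∣≡∣p∣+∣q∣ (take t p) (drop t p))) (cong ∣_∣ (take++drop≡id t p))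

module _ {t n : ℕ} (σ : Permutation′ (t + n)) (fixes-old : ∀ j → σ ⟨$⟩ʳ (t ↑ʳ j) ≡ t ↑ʳ j) where

  drop-image : (V : Subset (t + n)) → drop t (image σ V) ≡ drop t V
  drop-image V = trans (sym (tabulate∘lookup _)) (trans (tabulate-cong λ j → begin
    lookup (drop t (image σ V)) j  ≡⟨ lookup-drop t (image σ V) j ⟩
    lookup (image σ V) (t ↑ʳ j)    ≡⟨ lookup∘tabulate _ (t ↑ʳ j) ⟩
    lookup V (σ ⟨$⟩ˡ (t ↑ʳ j))     ≡⟨ cong (lookup V) σ⁻¹-fixes-old ⟩
    lookup V (t ↑ʳ j)              ≡⟨ lookup-drop t V j ⟨
    lookup (drop t V) j            ∎) (tabulate∘lookup _))
    where
    σ⁻¹-fixes-old : ∀ {j} → σ ⟨$⟩ˡ (t ↑ʳ j) ≡ t ↑ʳ j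
    σ⁻¹-fixes-old {j} = trans (cong (σ ⟨$⟩ˡ_) (sym (fixes-old j))) (inverseˡ σ)

  ∣take-image∣ : (V : Subset (t + n)) → ∣ take t (image σ V) ∣ ≡ ∣ take t V ∣
  ∣take-image∣ V = +-cancelʳ-≡ ∣ drop t V ∣ _ _ (begin
    ∣ take t W ∣ + ∣ drop t V ∣  ≡⟨ cong (λ D → ∣ take t W ∣ + ∣ D ∣) (drop-image V) ⟨
    ∣ take t W ∣ + ∣ drop t W ∣  ≡⟨ ∣take∣+∣drop∣≡∣p∣ t W ⟩
    ∣ W ∣                        ≡⟨ ∣image∣≡∣p∣ σ V ⟩
    ∣ V ∣                        ≡⟨ ∣take∣+∣drop∣≡∣p∣ t V ⟨
    ∣ take t V ∣ + ∣ drop t V ∣  ∎)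
    where W = image σ V

cardinality-only⇒clones : (F : RankFn (t + n)) (f : ℕ → Subset n → ℕ) →
                          (∀ S X → F (S ++ X) ≡ f ∣ S ∣ X) → IsClones F (newElts t n)
cardinality-only⇒clones {t} F f F-++ σ fixes V = begin
  F (image σ V)                                        ≡⟨ F-split (image σ V) ⟩
  f (∣ take t (image σ V) ∣) (drop t (image σ V))      ≡⟨ cong₂ f (∣take-image∣ σ fixes-old V) (drop-image σ fixes-old V) ⟩
  f (∣ take t V ∣) (drop t V)                          ≡⟨ F-split V ⟨
  F V                                                  ∎
  where
  F-split : ∀ U → F U ≡ f ∣ take t U ∣ (drop t U)
  F-split U = trans (cong F (sym (take++drop≡id t U))) (F-++ _ _)
  fixes-old : ∀ j → σ ⟨$⟩ʳ (t ↑ʳ j) ≡ t ↑ʳ j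
  fixes-old j = fixes _ (old∉newElts j)

λContr-from-ranks : (r : RankFn n) {X Z : Subset n} {a b c x : ℕ} →
                    r (Z ∪ X) ≡ a → r (∁ Z ∪ X) ≡ b → r ⊤ ≡ c → r X ≡ x →
                    λContr r X Z ≡ ((a ∸ x) + (b ∸ x)) ∸ (c ∸ x)
λContr-from-ranks r {X} {Z} refl refl refl refl =
  trans (cong₂ (λ A B → ((r A ∸ r X) + (r B ∸ r X)) ∸ (r ((⊤ ─ X) ∪ X) ∸ r X))
               (p─q∪q≡p∪q Z X) ([⊤─q]─[p─q]∪q≡∁p∪q Z X))
        (cong (λ E → ((r (Z ∪ X) ∸ r X) + (r (∁ Z ∪ X) ∸ r X)) ∸ (r E ∸ r X))
              (trans (p─q∪q≡p∪q ⊤ X) (∪-zeroˡ X)))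

module MonotoneRank {n : ℕ} {r : RankFn n} (r-mono : ∀ X Y → X ⊆ Y → r X ≤ r Y) where

  λContr-mono : (X Z : Subset n) → λContr r X Z ≡ (r (Z ∪ X) + r (∁ Z ∪ X)) ∸ (r ⊤ + r X)
  λContr-mono X Z = trans (λContr-from-ranks r refl refl refl refl)
    ([m∸o]+[n∸o]∸[p∸o]≡m+n∸[p+o] (r X) (r-mono X _ (q⊆p∪q Z X)) (r-mono X _ (q⊆p∪q (∁ Z) X)) (r-mono X ⊤ ⊆⊤))

  ⊆⇒λContr≡0 : {X Z : Subset n} → Z ⊆ X → λContr r X Z ≡ 0
  ⊆⇒λContr≡0 {X} {Z} Z⊆X = begin
    λContr r X Z                             ≡⟨ λContr-mono X Z ⟩
    (r (Z ∪ X) + r (∁ Z ∪ X)) ∸ (r ⊤ + r X)  ≡⟨ cong₂ (λ A B → (r A + r B) ∸ (r ⊤ + r X))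
                                                      (p⊆q⇒p∪q≡q Z⊆X) (p∪q≡⊤⇒p∪s≡⊤ (∪-inverseˡ Z) Z⊆X) ⟩
    (r X + r ⊤) ∸ (r ⊤ + r X)                ≡⟨ cong (_∸ (r ⊤ + r X)) (+-comm (r X) (r ⊤)) ⟩
    (r ⊤ + r X) ∸ (r ⊤ + r X)                ≡⟨ n∸n≡0 (r ⊤ + r X) ⟩
    0                                        ∎

  ∁⊆⇒λContr≡0 : {X Z : Subset n} → ∁ Z ⊆ X → λContr r X Z ≡ 0
  ∁⊆⇒λContr≡0 {X} {Z} ∁Z⊆X = begin
    λContr r X Z                             ≡⟨ λContr-mono X Z ⟩
    (r (Z ∪ X) + r (∁ Z ∪ X)) ∸ (r ⊤ + r X)  ≡⟨ cong₂ (λ A B → (r A + r B) ∸ (r ⊤ + r X))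
                                                      (p∪q≡⊤⇒p∪s≡⊤ (p∪∁p≡⊤ Z) ∁Z⊆X) (p⊆q⇒p∪q≡q ∁Z⊆X) ⟩
    (r ⊤ + r X) ∸ (r ⊤ + r X)                ≡⟨ n∸n≡0 (r ⊤ + r X) ⟩
    0                                        ∎

  λContr≡λM∸r : {Y Z : Subset n} → r (Z ∪ Y) ≡ r Z → r (∁ Z ∪ Y) ≡ r (∁ Z) → λContr r Y Z ≡ λM r Z ∸ r Y
  λContr≡λM∸r {Y} {Z} rZ∪Y≡rZ rA∪Y≡rA = begin
    λContr r Y Z                             ≡⟨ λContr-mono Y Z ⟩
    (r (Z ∪ Y) + r (∁ Z ∪ Y)) ∸ (r ⊤ + r Y)  ≡⟨ cong₂ (λ a b → (a + b) ∸ (r ⊤ + r Y)) rZ∪Y≡rZ rA∪Y≡rA ⟩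
    (r Z + r (∁ Z)) ∸ (r ⊤ + r Y)            ≡⟨ ∸-+-assoc (r Z + r (∁ Z)) (r ⊤) (r Y) ⟨
    ((r Z + r (∁ Z)) ∸ r ⊤) ∸ r Y            ≡⟨ cong (λ A → ((r Z + r A) ∸ r ⊤) ∸ r Y) (⊤─p≡∁p Z) ⟨
    λM r Z ∸ r Y                             ∎

module FreeAddition {n : ℕ} (r : RankFn n) (isMatroid : IsMatroid r) (Z : Subset n) where
  open IsMatroid isMatroid
  open MonotoneRank R2

  freeAdd-++ : ∀ t (S : Subset t) X → freeAdd t r Z (S ++ X) ≡ r X + (∣ S ∣ ⊓ λContr r X Z)
  λContr≡0⇒freeAdd≡r : ∀ t (S : Subset t) {Y} → λContr r Y Z ≡ 0 → freeAdd t r Z (S ++ Y) ≡ r Y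
  λContr-freeAdd : ∀ t (S : Subset t) X →
                   λContr (freeAdd t r Z) (S ++ X) (liftSub t Z) ≡ λContr r X Z ∸ ∣ S ∣

  freeAdd-++ zero    []          X = sym (+-identityʳ (r X))
  freeAdd-++ (suc t) (false ∷ S) X = freeAdd-++ t S X
  freeAdd-++ (suc t) (true ∷ S)  X = begin
      (if λContr F (S ++ X) (liftSub t Z) ≡ᵇ 0 then F (S ++ X) else suc (F (S ++ X)))
    ≡⟨ cong₂ (λ l v → if l ≡ᵇ 0 then v else suc v) (λContr-freeAdd t S X) (freeAdd-++ t S X) ⟩
      (if (k ∸ ∣ S ∣) ≡ᵇ 0 then r X + (∣ S ∣ ⊓ k) else suc (r X + (∣ S ∣ ⊓ k)))
    ≡⟨ +-⊓-step (r X) ∣ S ∣ k ⟩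
      r X + (suc ∣ S ∣ ⊓ k)
    ∎
    where
    F = freeAdd t r Z
    k = λContr r X Z

  λContr≡0⇒freeAdd≡r t S {Y} λContr≡0 = begin
    freeAdd t r Z (S ++ Y)        ≡⟨ freeAdd-++ t S Y ⟩
    r Y + (∣ S ∣ ⊓ λContr r Y Z)  ≡⟨ cong (λ k → r Y + (∣ S ∣ ⊓ k)) λContr≡0 ⟩
    r Y + (∣ S ∣ ⊓ 0)             ≡⟨ cong (r Y +_) (⊓-zeroʳ ∣ S ∣) ⟩
    r Y + 0                       ≡⟨ +-identityʳ (r Y) ⟩
    r Y                           ∎

  λContr-freeAdd t S X = begin
      λContr F (S ++ X) L
    ≡⟨ λContr-from-ranks F F[L∪SX]≡a F[∁L∪SX]≡b F⊤≡c (freeAdd-++ t S X) ⟩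
      ((a ∸ (x + m)) + (b ∸ (x + m))) ∸ (c ∸ (x + m))
    ≡⟨ [m∸o]+[n∸o]∸[p∸o]≡m+n∸[p+o] (x + m) x+m≤a x+m≤b (≤-trans x+m≤a a≤c) ⟩
      (a + b) ∸ (c + (x + m))
    ≡⟨ cong ((a + b) ∸_) (+-assoc c x m) ⟨
      (a + b) ∸ ((c + x) + m)
    ≡⟨ ∸-+-assoc (a + b) (c + x) m ⟨
      ((a + b) ∸ (c + x)) ∸ m
    ≡⟨ cong (_∸ m) (λContr-mono X Z) ⟨
      k ∸ (∣ S ∣ ⊓ k)
    ≡⟨ m∸[n⊓m]≡m∸n k ∣ S ∣ ⟩
      k ∸ ∣ S ∣
    ∎
    where
    F = freeAdd t r Z
    L = liftSub t Z
    a = r (Z ∪ X)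
    b = r (∁ Z ∪ X)
    c = r ⊤
    x = r X
    k = λContr r X Z
    m = ∣ S ∣ ⊓ k
    a≤c : a ≤ c
    a≤c = R2 _ ⊤ ⊆⊤
    m≤k : m ≤ (a + b) ∸ (c + x)
    m≤k = ≤-trans (m⊓n≤n ∣ S ∣ k) (≤-reflexive (λContr-mono X Z))
    x+m≤a : x + m ≤ a
    x+m≤a = k≤[a+b]∸[c+x]⇒x+k≤a (R2 X _ (q⊆p∪q Z X)) (R2 _ ⊤ ⊆⊤) m≤k
    x+m≤b : x + m ≤ b
    x+m≤b = k≤[a+b]∸[c+x]⇒x+k≤a (R2 X _ (q⊆p∪q (∁ Z) X)) a≤c (subst (λ u → m ≤ u ∸ (c + x)) (+-comm a b) m≤k)
    F[L∪SX]≡a : F (L ∪ (S ++ X)) ≡ a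
    F[L∪SX]≡a = trans (cong F (zipWith-++ _∨_ ⊥ Z S X))
                      (λContr≡0⇒freeAdd≡r t (⊥ ∪ S) (⊆⇒λContr≡0 (p⊆p∪q X)))
    F[∁L∪SX]≡b : F (∁ L ∪ (S ++ X)) ≡ b
    F[∁L∪SX]≡b = trans (cong F (trans (cong (_∪ (S ++ X)) (map-++ not ⊥ Z)) (zipWith-++ _∨_ (∁ ⊥) (∁ Z) S X)))
                       (λContr≡0⇒freeAdd≡r t (∁ ⊥ ∪ S) (∁⊆⇒λContr≡0 (p⊆p∪q X)))
    F⊤≡c : F ⊤ ≡ c
    F⊤≡c = trans (cong F (replicate-++ t true)) (λContr≡0⇒freeAdd≡r t ⊤ (⊆⇒λContr≡0 ⊆⊤))

  freeAdd-liftSub : ∀ t Y → freeAdd t r Z (liftSub t Y) ≡ r Y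
  freeAdd-liftSub t Y = begin
    freeAdd t r Z (⊥ ++ Y)         ≡⟨ freeAdd-++ t ⊥ Y ⟩
    r Y + (∣ ⊥ {t} ∣ ⊓ λContr r Y Z) ≡⟨ cong (λ s → r Y + (s ⊓ λContr r Y Z)) (∣⊥∣≡0 t) ⟩
    r Y + 0                        ≡⟨ +-identityʳ (r Y) ⟩
    r Y                            ∎

  r⊥≡0 : r ⊥ ≡ 0
  r⊥≡0 = n≤0⇒n≡0 (subst (r ⊥ ≤_) (∣⊥∣≡0 n) (R1 ⊥))

  freeAdd-newElts : ∀ t → freeAdd t r Z (newElts t n) ≡ t ⊓ λM r Z
  freeAdd-newElts t = begin
    freeAdd t r Z (newElts t n)          ≡⟨ freeAdd-++ t ⊤ ⊥ ⟩
    r ⊥ + (∣ ⊤ {t} ∣ ⊓ λContr r ⊥ Z)     ≡⟨ cong₂ (λ a s → a + (s ⊓ λContr r ⊥ Z)) r⊥≡0 (∣⊤∣≡n t) ⟩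
    t ⊓ λContr r ⊥ Z                     ≡⟨ cong (t ⊓_) λContr-⊥ ⟩
    t ⊓ λM r Z                           ∎
    where
    λContr-⊥ : λContr r ⊥ Z ≡ λM r Z
    λContr-⊥ = trans (λContr≡λM∸r (cong r (∪-identityʳ Z)) (cong r (∪-identityʳ (∁ Z))))
                     (cong (λM r Z ∸_) r⊥≡0)

  ∣newElts∣≡t : ∀ t → ∣ newElts t n ∣ ≡ t
  ∣newElts∣≡t t = trans (∣p++q∣≡∣p∣+∣q∣ (⊤ {t}) (⊥ {n})) (trans (cong₂ _+_ (∣⊤∣≡n t) (∣⊥∣≡0 n)) (+-identityʳ t))

  newElts-independent : ∀ {t} → t ≤ λM r Z → Independent (freeAdd t r Z) (newElts t n)
  newElts-independent {t} t≤λ = trans (freeAdd-newElts t) (trans (m≤n⇒m⊓n≡m t≤λ) (sym (∣newElts∣≡t t)))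

  newElts-clones : ∀ t → IsClones (freeAdd t r Z) (newElts t n)
  newElts-clones t = cardinality-only⇒clones (freeAdd t r Z) (λ s X → r X + (s ⊓ λContr r X Z)) (freeAdd-++ t)

  newElts⊆cl : ∀ t {W} → λContr r W Z ≡ 0 → newElts t n ⊆ cl (freeAdd t r Z) (liftSub t W)
  newElts⊆cl t {W} λContr≡0 {x} x∈N with newOrOld t x
  ... | new i = ∈cl⁺ (freeAdd t r Z) (begin
        freeAdd t r Z (liftSub t W ∪ ⁅ i ↑ˡ n ⁆)  ≡⟨ cong (freeAdd t r Z) (liftSub∪⁅new⁆ t W i) ⟩
        freeAdd t r Z (⁅ i ⁆ ++ W)                ≡⟨ λContr≡0⇒freeAdd≡r t ⁅ i ⁆ λContr≡0 ⟩
        r W                                       ≡⟨ freeAdd-liftSub t W ⟨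
        freeAdd t r Z (liftSub t W)               ∎)
  ... | old j = contradiction x∈N (old∉newElts j)

  old∈cl⇒∈cl : ∀ t {W j} → t ↑ʳ j ∈ cl (freeAdd t r Z) (liftSub t W) → j ∈ cl r W
  old∈cl⇒∈cl t {W} {j} j∈cl = ∈cl⁺ r (begin
    r (W ∪ ⁅ j ⁆)                              ≡⟨ freeAdd-liftSub t (W ∪ ⁅ j ⁆) ⟨
    freeAdd t r Z (liftSub t (W ∪ ⁅ j ⁆))      ≡⟨ cong (freeAdd t r Z) (liftSub∪⁅old⁆ t W j) ⟨
    freeAdd t r Z (liftSub t W ∪ ⁅ t ↑ʳ j ⁆)  ≡⟨ ∈cl⁻ (freeAdd t r Z) j∈cl ⟩
    freeAdd t r Z (liftSub t W)                ≡⟨ freeAdd-liftSub t W ⟩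
    r W                                        ∎)

  cl∩cl⊆cl-newElts : ∀ {t} → λM r Z ≡ t → 0 < t →
                     let F = freeAdd t r Z in
                     cl F (liftSub t (∁ Z)) ∩ cl F (liftSub t Z) ⊆ cl F (newElts t n)
  cl∩cl⊆cl-newElts {t} λ≡t 0<t {x} x∈cl∩cl with newOrOld t x
  ... | new i = ∈⇒∈cl (freeAdd t r Z) (new∈newElts i)
  ... | old j = ∈cl⁺ F (begin
        F (newElts t n ∪ ⁅ t ↑ʳ j ⁆)              ≡⟨ cong F (newElts∪⁅old⁆ t j) ⟩
        F (⊤ ++ ⁅ j ⁆)                            ≡⟨ freeAdd-++ t ⊤ ⁅ j ⁆ ⟩
        r ⁅ j ⁆ + (∣ ⊤ {t} ∣ ⊓ λContr r ⁅ j ⁆ Z)  ≡⟨ cong₂ (λ s k → r ⁅ j ⁆ + (s ⊓ k)) (∣⊤∣≡n t) λContr≡t∸r ⟩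
        r ⁅ j ⁆ + (t ⊓ (t ∸ r ⁅ j ⁆))             ≡⟨ cong (r ⁅ j ⁆ +_) (m≥n⇒m⊓n≡n (m∸n≤m t (r ⁅ j ⁆))) ⟩
        r ⁅ j ⁆ + (t ∸ r ⁅ j ⁆)                   ≡⟨ m+[n∸m]≡n r⁅j⁆≤t ⟩
        t                                         ≡⟨ trans (newElts-independent (≤-reflexive (sym λ≡t))) (∣newElts∣≡t t) ⟨
        F (newElts t n)                           ∎)
    where
    F = freeAdd t r Z
    r⁅j⁆≤t : r ⁅ j ⁆ ≤ t
    r⁅j⁆≤t = ≤-trans (subst (r ⁅ j ⁆ ≤_) (∣⁅x⁆∣≡1 j) (R1 ⁅ j ⁆)) 0<t
    j∈clA×j∈clZ = x∈p∩q⁻ _ _ x∈cl∩cl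
    λContr≡t∸r : λContr r ⁅ j ⁆ Z ≡ t ∸ r ⁅ j ⁆
    λContr≡t∸r = trans (λContr≡λM∸r (∈cl⁻ r (old∈cl⇒∈cl t (proj₂ j∈clA×j∈clZ)))
                                    (∈cl⁻ r (old∈cl⇒∈cl t (proj₁ j∈clA×j∈clZ))))
                       (cong (_∸ r ⁅ j ⁆) λ≡t)

theorem3p9 : (n : ℕ) (r : RankFn n) → IsMatroid r → (Z : Subset n) (t : ℕ) →
    λM r Z ≡ t → 0 < t →
    Independent (freeAdd t r Z) (newElts t n)
    × IsClones (freeAdd t r Z) (newElts t n)
    × newElts t n ⊆ (cl (freeAdd t r Z) (liftSub t (∁ Z)) ∩ cl (freeAdd t r Z) (liftSub t Z))
    × (cl (freeAdd t r Z) (liftSub t (∁ Z)) ∩ cl (freeAdd t r Z) (liftSub t Z)) ⊆ cl (freeAdd t r Z) (newElts t n)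
theorem3p9 n r isMatroid Z t λ≡t 0<t =
    newElts-independent (≤-reflexive (sym λ≡t))
  , newElts-clones t
  , (λ x∈N → x∈p∩q⁺ (newElts⊆cl t (∁⊆⇒λContr≡0 ⊆-refl) x∈N , newElts⊆cl t (⊆⇒λContr≡0 ⊆-refl) x∈N))
  , cl∩cl⊆cl-newElts λ≡t 0<t
  where
  open IsMatroid isMatroid
  open MonotoneRank R2
  open FreeAddition r isMatroid Z
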